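{- Let $S\subset\mathbb{N}$ be finite and let $N\ge 1$ be an integer. Suppose there exists a finite directed (rooted, edges directed away from the root) tree $T=(V,E)$, in which every leaf is at most $N-1$ edges from the root, with the following properties: (1) the vertices are distinct rational numbers; (2) for every branch (directed path from the root to a leaf), the set of rationals on that branch contains a copy of $S$; (3) every vertex which is neither a leaf nor the root has out-degree at least $2$. Then Maker has an $N$-move strategy in the game for $S$.
   Context: Game for $S$: for a fixed finite set $S\subset\mathbb{N}$, two players, Maker and Breaker, alternately choose previously unchosen natural numbers, Maker choosing first. Maker wins as soon as the set of Maker's choices contains $aS+b$ for some $a\in\mathbb{N}\setminus\{0\}$ and $b\in\mathbb{Z}$. Maker has an $N$-move strategy if Maker has a strategy guaranteeing a win using at most $N$ selections, whatever Breaker does. For $R,R'\subset\mathbb{Q}$, $R'$ is a copy of $R$ if $R'=aR+b$ for some $a\in\mathbb{Q}$ with $a>0$ and some $b\in\mathbb{Q}$. -}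

module Defs where

open import Data.Nat as ℕ using (ℕ; zero; suc; _≤_; _∸_)
open import Data.Integer as ℤ using (ℤ; +_)
open import Data.Rational as ℚ using (ℚ; 0ℚ)
open import Data.List using (List; []; _∷_; _++_; length)
open import Data.List.Relation.Unary.All using (All)
open import Data.List.Membership.Propositional using (_∈_; _∉_)
open import Data.Product using (Σ; ∃; _×_; _,_)
open import Data.Sum using (_⊎_)
open import Data.Empty using (⊥)
open import Relation.Binary.PropositionalEquality using (_≡_)

ℕ→ℚ : ℕ → ℚ
ℕ→ℚ n = (+ n) ℚ./ 1

ContainsAffineCopy : List ℕ → List ℕ → Set
ContainsAffineCopy S M =
  Σ ℕ λ a → 1 ≤ a × Σ ℤ λ b →
    All (λ s → Σ ℕ λ m → m ∈ M × (+ m ≡ (+ (a ℕ.* s)) ℤ.+ b)) S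

-- MakerWinsWithin S k M B : in the position where Maker has chosen M,
-- Breaker has chosen B, and it is Maker's turn, Maker has a strategy
-- guaranteeing a win using at most k further selections, whatever
-- Breaker does.  (Maker picks an unchosen x; either Maker has won, or
-- for every unchosen reply y of Breaker, Maker wins within k-1 more.)
MakerWinsWithin : List ℕ → ℕ → List ℕ → List ℕ → Set
MakerWinsWithin S zero    M B = ⊥
MakerWinsWithin S (suc k) M B =
  Σ ℕ λ x → x ∉ M × x ∉ B ×
    (ContainsAffineCopy S (x ∷ M)
     ⊎ (∀ y → y ∉ x ∷ M → y ∉ B → MakerWinsWithin S k (x ∷ M) (y ∷ B)))

HasNMoveStrategy : List ℕ → ℕ → Set
HasNMoveStrategy S N = MakerWinsWithin S N [] []

ContainsCopyℚ : List ℕ → List ℚ → Set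
ContainsCopyℚ S R =
  Σ ℚ λ a → 0ℚ ℚ.< a × Σ ℚ λ b → All (λ s → (a ℚ.* ℕ→ℚ s ℚ.+ b) ∈ R) S

data Tree : Set where
  node : ℚ → List Tree → Tree

labels  : Tree → List ℚ
labelsF : List Tree → List ℚ
labels (node q ts) = q ∷ labelsF ts
labelsF []       = []
labelsF (t ∷ ts) = labels t ++ labelsF ts

data Depth≤ : ℕ → Tree → Set where
  leaf  : ∀ {n q} → Depth≤ n (node q [])
  inner : ∀ {n q ts} → All (Depth≤ n) ts → Depth≤ (suc n) (node q ts)

data Branch : Tree → List ℚ → Set where
  leafB : ∀ {q} → Branch (node q []) (q ∷ [])
  stepB : ∀ {q t ts bs} → t ∈ ts → Branch t bs → Branch (node q ts) (q ∷ bs)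

data AllInnerBranching : Tree → Set where
  nd : ∀ {q ts} → (ts ≡ [] ⊎ 2 ≤ length ts) → All AllInnerBranching ts →
       AllInnerBranching (node q ts)

NonRootBranching : Tree → Set
NonRootBranching (node q ts) = All AllInnerBranching ts

-- Maker first claims a number R for the root q₀ of T. Clearing denominators and
-- scaling, q ↦ w q is an injective map from the labels of T to ℤ, vanishing at q₀,
-- that sends every copy of S in ℚ to an integral copy a·S + b with a ≥ 1; then so
-- does q ↦ R + m · w q for every multiplier m ≥ 1, and R is taken so large that
-- these values are natural for all m ≤ K := 2^|T|. Once Breaker has answered y,
-- each non-root vertex q rules out at most one m (namely m · w q = y − R), so
-- Maker can fix m ≤ K for which no vertex below the root is labelled y.
-- From there Maker walks down the tree claiming the labels of the vertices she
-- visits: a reply of Breaker lies in at most one of the ≥ 2 subtrees of the current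
-- vertex, so she moves into one free of Breaker's numbers. After at most N moves she
-- owns the labels of a whole branch, and these contain a copy of S.

module Submission where

open import Defs
open import Level using (0ℓ)
open import Function using (_∘′_)
open import Data.Empty using (⊥-elim)
open import Data.Product using (Σ; ∃; _×_; _,_; proj₁; proj₂)
open import Data.Sum using (_⊎_; inj₁; inj₂; [_,_]′)
open import Data.Nat as ℕ using (ℕ; zero; suc; _≤_; _<_; _∸_; s≤s; z≤n; _^_)
import Data.Nat.Properties as ℕP
open import Data.Nat.Divisibility using (divides)
open import Data.Nat.ListAction using (sum; product)
open import Data.Nat.ListAction.Properties using (∈⇒∣product; product≢0)
open import Data.Nat.Tactic.RingSolver renaming (solve-∀ to ℕ-solve-∀)
open import Data.Integer as ℤ using (ℤ; +_; 0ℤ)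
import Data.Integer.Properties as ℤP
import Data.Integer.GCD as ℤGCD
open import Data.Integer.Tactic.RingSolver renaming (solve-∀ to ℤ-solve-∀)
open import Data.Rational as ℚ using (ℚ; 0ℚ)
import Data.Rational.Properties as ℚP
open import Data.Rational.Unnormalised as ℚᵘ using (mkℚᵘ; *≡*; *<*)
import Data.Rational.Unnormalised.Properties as ℚᵘP
open import Data.List using (List; []; _∷_; _++_; map; length)
open import Data.List.Properties using (map-++)
open import Data.List.Relation.Unary.All as All using (All; []; _∷_)
import Data.List.Relation.Unary.All.Properties as All
open import Data.List.Relation.Unary.Any using (here; there)
open import Data.List.Relation.Unary.AllPairs as AllPairs using ([]; _∷_)
open import Data.List.Relation.Unary.Unique.Propositional using (Unique)
open import Data.List.Membership.Propositional using (_∈_; _∉_; find)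
open import Data.List.Membership.Propositional.Properties using (∈-map⁺; ∈-map⁻; ∈-++⁺ˡ; ∈-++⁺ʳ)
open import Data.List.Membership.DecPropositional ℕ._≟_ using (_∈?_)
open import Data.List.Relation.Binary.Subset.Propositional using (_⊆_)
import Data.List.Relation.Binary.Subset.Propositional.Properties as Subset
open import Data.List.Relation.Binary.Disjoint.Propositional using (Disjoint)
open import Data.List.Relation.Binary.Permutation.Propositional.Properties using (∈-resp-↭; ++-comm; shift)
open import Relation.Nullary using (yes; no)
open import Relation.Nullary.Decidable using (dec⇒maybe)
open import Relation.Binary using (tri<; tri≈; tri>)
open import Relation.Binary.PropositionalEquality
open import Tactic.RingSolver using (solve-∀)
import Tactic.RingSolver.Core.AlmostCommutativeRing as ACR

ℚ-ring : ACR.AlmostCommutativeRing 0ℓ 0ℓ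
ℚ-ring = ACR.fromCommutativeRing ℚP.+-*-commutativeRing (λ q → dec⇒maybe (0ℚ ℚP.≟ q))

-- Integers inside the rationals

-- By definition ℕ→ℚ n is ℤ→ℚ (+ n).
ℤ→ℚ : ℤ → ℚ
ℤ→ℚ k = k ℚ./ 1

toℚᵘ-ℤ→ℚ : ∀ k → ℚ.toℚᵘ (ℤ→ℚ k) ℚᵘ.≃ mkℚᵘ k 0
toℚᵘ-ℤ→ℚ k = ℚP.toℚᵘ-fromℚᵘ (mkℚᵘ k 0)

toℚᵘ≃⇒≡ℤ→ℚ : ∀ {p} k → ℚ.toℚᵘ p ℚᵘ.≃ mkℚᵘ k 0 → p ≡ ℤ→ℚ k
toℚᵘ≃⇒≡ℤ→ℚ k p≃k = ℚP.toℚᵘ-injective (ℚᵘP.≃-trans p≃k (ℚᵘP.≃-sym (toℚᵘ-ℤ→ℚ k)))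

ℤ→ℚ-+ : ∀ a b → ℤ→ℚ (a ℤ.+ b) ≡ ℤ→ℚ a ℚ.+ ℤ→ℚ b
ℤ→ℚ-+ a b = sym (toℚᵘ≃⇒≡ℤ→ℚ (a ℤ.+ b) (ℚᵘP.≃-trans (ℚP.toℚᵘ-homo-+ (ℤ→ℚ a) (ℤ→ℚ b))
  (ℚᵘP.≃-trans (ℚᵘP.+-cong (toℚᵘ-ℤ→ℚ a) (toℚᵘ-ℤ→ℚ b)) (*≡* (unit-denominators a b)))))
  where
  unit-denominators : ∀ a b → (a ℤ.* + 1 ℤ.+ b ℤ.* + 1) ℤ.* + 1 ≡ (a ℤ.+ b) ℤ.* + 1
  unit-denominators = ℤ-solve-∀

ℤ→ℚ-* : ∀ a b → ℤ→ℚ (a ℤ.* b) ≡ ℤ→ℚ a ℚ.* ℤ→ℚ b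
ℤ→ℚ-* a b = sym (toℚᵘ≃⇒≡ℤ→ℚ (a ℤ.* b)
  (ℚᵘP.≃-trans (ℚP.toℚᵘ-homo-* (ℤ→ℚ a) (ℤ→ℚ b)) (ℚᵘP.*-cong (toℚᵘ-ℤ→ℚ a) (toℚᵘ-ℤ→ℚ b))))

ℤ→ℚ-- : ∀ a b → ℤ→ℚ (a ℤ.- b) ≡ ℤ→ℚ a ℚ.- ℤ→ℚ b
ℤ→ℚ-- a b = trans (ℤ→ℚ-+ a (ℤ.- b)) (cong (ℤ→ℚ a ℚ.+_) (sym (toℚᵘ≃⇒≡ℤ→ℚ (ℤ.- b)
  (ℚᵘP.≃-trans (ℚP.toℚᵘ-homo‿- (ℤ→ℚ b)) (ℚᵘP.-‿cong (toℚᵘ-ℤ→ℚ b))))))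

ℤ→ℚ-injective : ∀ {a b} → ℤ→ℚ a ≡ ℤ→ℚ b → a ≡ b
ℤ→ℚ-injective {a} {b} eq with ℚᵘP.≃-trans (ℚᵘP.≃-sym (toℚᵘ-ℤ→ℚ a)) (ℚᵘP.≃-trans (ℚP.toℚᵘ-cong eq) (toℚᵘ-ℤ→ℚ b))
... | *≡* a*1≡b*1 = trans (sym (ℤP.*-identityʳ a)) (trans a*1≡b*1 (ℤP.*-identityʳ b))

ℤ→ℚ-mono-< : ∀ {a b} → a ℤ.< b → ℤ→ℚ a ℚ.< ℤ→ℚ b
ℤ→ℚ-mono-< {a} {b} a<b = ℚP.toℚᵘ-cancel-< (ℚᵘP.<-respʳ-≃ (ℚᵘP.≃-sym (toℚᵘ-ℤ→ℚ b))
  (ℚᵘP.<-respˡ-≃ (ℚᵘP.≃-sym (toℚᵘ-ℤ→ℚ a)) (*<* (ℤP.*-monoʳ-<-pos (+ 1) a<b))))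

ℤ→ℚ-cancel-< : ∀ {a b} → ℤ→ℚ a ℚ.< ℤ→ℚ b → a ℤ.< b
ℤ→ℚ-cancel-< {a} {b} lt with ℚᵘP.<-respʳ-≃ (toℚᵘ-ℤ→ℚ b) (ℚᵘP.<-respˡ-≃ (toℚᵘ-ℤ→ℚ a) (ℚP.toℚᵘ-mono-< lt))
... | *<* a*1<b*1 = subst₂ ℤ._<_ (ℤP.*-identityʳ a) (ℤP.*-identityʳ b) a*1<b*1

↥-ℤ→ℚ : ∀ k → ℚ.↥ (ℤ→ℚ k) ≡ k
↥-ℤ→ℚ k = trans (sym (ℤP.*-identityʳ _)) (trans (cong (ℚ.↥ (ℤ→ℚ k) ℤ.*_) (sym (ℤGCD.gcd-zeroʳ k))) (ℚP.↥-/ k 1))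

↧*≡↥ : ∀ q → ℤ→ℚ (ℚ.↧ q) ℚ.* q ≡ ℤ→ℚ (ℚ.↥ q)
↧*≡↥ q@(ℚ.mkℚ n d-1 _) = toℚᵘ≃⇒≡ℤ→ℚ n (ℚᵘP.≃-trans (ℚP.toℚᵘ-homo-* (ℤ→ℚ (+ suc d-1)) q)
  (ℚᵘP.≃-trans (ℚᵘP.*-congʳ (toℚᵘ-ℤ→ℚ (+ suc d-1))) (*≡* (cross-multiplied n (+ suc d-1)))))
  where
  cross-multiplied : ∀ n d → (d ℤ.* n) ℤ.* + 1 ≡ n ℤ.* (+ 1 ℤ.* d)
  cross-multiplied = ℤ-solve-∀

ℕ→ℚ-+ : ∀ m n → ℕ→ℚ (m ℕ.+ n) ≡ ℕ→ℚ m ℚ.+ ℕ→ℚ n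
ℕ→ℚ-+ m n = trans (cong ℤ→ℚ (ℤP.pos-+ m n)) (ℤ→ℚ-+ (+ m) (+ n))

ℤ→ℚ-[-]* : ∀ u v w → ℤ→ℚ ((u ℤ.- v) ℤ.* w) ≡ (ℤ→ℚ u ℚ.- ℤ→ℚ v) ℚ.* ℤ→ℚ w
ℤ→ℚ-[-]* u v w = trans (ℤ→ℚ-* (u ℤ.- v) w) (cong (ℚ._* ℤ→ℚ w) (ℤ→ℚ-- u v))

-- Affine copies

ContainsCopyℤ : List ℕ → List ℤ → Set
ContainsCopyℤ S zs = Σ ℕ λ a → 1 ≤ a × Σ ℤ λ b → All (λ s → + (a ℕ.* s) ℤ.+ b ∈ zs) S

data Spread (S : List ℕ) : ℕ → Set where
  constant : ∀ s₀ → All (_≡ s₀) S → Spread S 1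
  spread   : ∀ {s d} → s ∈ S → s ℕ.+ suc d ∈ S → Spread S (suc d)

Spread⇒NonZero : ∀ {S d} → Spread S d → ℕ.NonZero d
Spread⇒NonZero (constant _ _) = _
Spread⇒NonZero (spread _ _) = _

spread< : ∀ {S s t} → s ∈ S → t ∈ S → s < t → ∃ (Spread S)
spread< {S} s∈ t∈ s<t = _ , spread s∈ (subst (_∈ S) (sym (trans (ℕP.+-suc _ _) (ℕP.m+[n∸m]≡n s<t))) t∈)

spread? : ∀ S → ∃ (Spread S)
spread? [] = 1 , constant 0 []
spread? (s ∷ S) with All.all? (ℕ._≟ s) (s ∷ S)
... | yes all≡s = 1 , constant s all≡s
... | no ¬all≡s with find (All.¬All⇒Any¬ (ℕ._≟ s) (s ∷ S) ¬all≡s)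
... | t , t∈ , t≢s with ℕP.<-cmp t s
... | tri< t<s _ _ = spread< t∈ (here refl) t<s
... | tri≈ _ t≡s _ = ⊥-elim (t≢s t≡s)
... | tri> _ _ s<t = spread< (here refl) t∈ s<t

line : ℚ → ℚ → ℕ → ℚ
line a b s = a ℚ.* ℕ→ℚ s ℚ.+ b

0<⇒≡+suc : ∀ {i} → 0ℤ ℤ.< i → ∃ λ n → i ≡ + suc n
0<⇒≡+suc {+ suc n} _ = n , refl
0<⇒≡+suc {+ zero} (ℤ.+<+ ())

-- Clearing denominators

module Clearing (Ls : List ℚ) where

  D : ℕ
  D = product (map ℚ.↧ₙ_ Ls)

  instance
    D-nonZero : ℕ.NonZero D
    D-nonZero = product≢0 (All.map⁺ (All.universal (λ q → _) Ls))

  Dℚ : ℚ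
  Dℚ = ℤ→ℚ (+ D)

  instance
    Dℚ-positive : ℚ.Positive Dℚ
    Dℚ-positive = ℚP.normalize-pos D 1

  Z : ℚ → ℤ
  Z q = ℚ.↥ (Dℚ ℚ.* q)

  Dℚ*-integral : ∀ {q} → q ∈ Ls → ∃ λ j → Dℚ ℚ.* q ≡ ℤ→ℚ j
  Dℚ*-integral {q} q∈ with ∈⇒∣product (∈-map⁺ ℚ.↧ₙ_ q∈)
  ... | divides k D≡k*↧q = + k ℤ.* ℚ.↥ q , (begin
    ℤ→ℚ (+ D) ℚ.* q                             ≡⟨ cong (λ n → ℤ→ℚ (+ n) ℚ.* q) D≡k*↧q ⟩
    ℤ→ℚ (+ (k ℕ.* ℚ.↧ₙ q)) ℚ.* q                ≡⟨ cong (λ n → ℤ→ℚ n ℚ.* q) (ℤP.pos-* k (ℚ.↧ₙ q)) ⟩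
    ℤ→ℚ (+ k ℤ.* ℚ.↧ q) ℚ.* q                   ≡⟨ cong (ℚ._* q) (ℤ→ℚ-* (+ k) (ℚ.↧ q)) ⟩
    (ℤ→ℚ (+ k) ℚ.* ℤ→ℚ (ℚ.↧ q)) ℚ.* q           ≡⟨ ℚP.*-assoc (ℤ→ℚ (+ k)) (ℤ→ℚ (ℚ.↧ q)) q ⟩
    ℤ→ℚ (+ k) ℚ.* (ℤ→ℚ (ℚ.↧ q) ℚ.* q)           ≡⟨ cong (ℤ→ℚ (+ k) ℚ.*_) (↧*≡↥ q) ⟩
    ℤ→ℚ (+ k) ℚ.* ℤ→ℚ (ℚ.↥ q)                   ≡⟨ ℤ→ℚ-* (+ k) (ℚ.↥ q) ⟨
    ℤ→ℚ (+ k ℤ.* ℚ.↥ q)                         ∎)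
    where open ≡-Reasoning

  Z-clears : ∀ {q} → q ∈ Ls → ℤ→ℚ (Z q) ≡ Dℚ ℚ.* q
  Z-clears q∈ =
    let j , Dq≡j = Dℚ*-integral q∈
    in trans (cong (ℤ→ℚ ∘′ ℚ.↥_) Dq≡j) (trans (cong ℤ→ℚ (↥-ℤ→ℚ j)) (sym Dq≡j))

  Z-injective : ∀ {q q′} → q ∈ Ls → q′ ∈ Ls → Z q ≡ Z q′ → q ≡ q′
  Z-injective q∈ q′∈ Zq≡Zq′ = ℚP.≤-antisym (cancel Dq≡Dq′) (cancel (sym Dq≡Dq′))
    where
    Dq≡Dq′ = trans (sym (Z-clears q∈)) (trans (cong ℤ→ℚ Zq≡Zq′) (Z-clears q′∈))
    cancel : ∀ {p p′} → Dℚ ℚ.* p ≡ Dℚ ℚ.* p′ → p ℚ.≤ p′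
    cancel e = ℚP.*-cancelˡ-≤-pos Dℚ (ℚP.≤-reflexive e)

  module _ (a b : ℚ) where

    Z-line-< : ∀ {s t} → 0ℚ ℚ.< a → s < t → line a b s ∈ Ls → line a b t ∈ Ls →
               Z (line a b s) ℤ.< Z (line a b t)
    Z-line-< {s} {t} a>0 s<t s∈ t∈ = ℤ→ℚ-cancel-< (subst₂ ℚ._<_ (sym (Z-clears s∈)) (sym (Z-clears t∈))
      (ℚP.*-monoʳ-<-pos Dℚ (ℚP.+-monoˡ-< b (ℚP.*-monoʳ-<-pos a {{ℚ.positive a>0}} (ℤ→ℚ-mono-< (ℤ.+<+ s<t))))))

    Z-line-proportional : ∀ s₁ d s → line a b s₁ ∈ Ls → line a b (s₁ ℕ.+ d) ∈ Ls → line a b s ∈ Ls →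
      (Z (line a b s) ℤ.- Z (line a b s₁)) ℤ.* + d
        ≡ (Z (line a b (s₁ ℕ.+ d)) ℤ.- Z (line a b s₁)) ℤ.* (+ s ℤ.- + s₁)
    Z-line-proportional s₁ d s s₁∈ s₂∈ s∈ = ℤ→ℚ-injective (begin
      ℤ→ℚ ((Z x ℤ.- Z x₁) ℤ.* + d)
        ≡⟨ ℤ→ℚ-[-]* (Z x) (Z x₁) (+ d) ⟩
      (ℤ→ℚ (Z x) ℚ.- ℤ→ℚ (Z x₁)) ℚ.* ℕ→ℚ d
        ≡⟨ cong₂ (λ u v → (u ℚ.- v) ℚ.* ℕ→ℚ d) (Z-clears s∈) (Z-clears s₁∈) ⟩
      (Dℚ ℚ.* x ℚ.- Dℚ ℚ.* x₁) ℚ.* ℕ→ℚ d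
        ≡⟨ collinear Dℚ a b (ℕ→ℚ s) (ℕ→ℚ s₁) (ℕ→ℚ d) ⟩
      (Dℚ ℚ.* (a ℚ.* (ℕ→ℚ s₁ ℚ.+ ℕ→ℚ d) ℚ.+ b) ℚ.- Dℚ ℚ.* x₁) ℚ.* (ℕ→ℚ s ℚ.- ℕ→ℚ s₁)
        ≡⟨ cong (λ r → (Dℚ ℚ.* (a ℚ.* r ℚ.+ b) ℚ.- Dℚ ℚ.* x₁) ℚ.* (ℕ→ℚ s ℚ.- ℕ→ℚ s₁)) (ℕ→ℚ-+ s₁ d) ⟨
      (Dℚ ℚ.* x₂ ℚ.- Dℚ ℚ.* x₁) ℚ.* (ℕ→ℚ s ℚ.- ℕ→ℚ s₁)
        ≡⟨ cong₂ (λ u v → (u ℚ.- v) ℚ.* (ℕ→ℚ s ℚ.- ℕ→ℚ s₁)) (Z-clears s₂∈) (Z-clears s₁∈) ⟨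
      (ℤ→ℚ (Z x₂) ℚ.- ℤ→ℚ (Z x₁)) ℚ.* (ℕ→ℚ s ℚ.- ℕ→ℚ s₁)
        ≡⟨ cong ((ℤ→ℚ (Z x₂) ℚ.- ℤ→ℚ (Z x₁)) ℚ.*_) (ℤ→ℚ-- (+ s) (+ s₁)) ⟨
      (ℤ→ℚ (Z x₂) ℚ.- ℤ→ℚ (Z x₁)) ℚ.* ℤ→ℚ (+ s ℤ.- + s₁)
        ≡⟨ ℤ→ℚ-[-]* (Z x₂) (Z x₁) (+ s ℤ.- + s₁) ⟨
      ℤ→ℚ ((Z x₂ ℤ.- Z x₁) ℤ.* (+ s ℤ.- + s₁))
        ∎)
      where
      open ≡-Reasoning
      x = line a b s
      x₁ = line a b s₁
      x₂ = line a b (s₁ ℕ.+ d)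
      collinear : ∀ e a b s s₁ d → (e ℚ.* (a ℚ.* s ℚ.+ b) ℚ.- e ℚ.* (a ℚ.* s₁ ℚ.+ b)) ℚ.* d
                  ≡ (e ℚ.* (a ℚ.* (s₁ ℚ.+ d) ℚ.+ b) ℚ.- e ℚ.* (a ℚ.* s₁ ℚ.+ b)) ℚ.* (s ℚ.- s₁)
      collinear = solve-∀ ℚ-ring

  -- The slope Dℚ · a of Z along a copy need not be integral, but d times it is
  -- Z (x s₂) − Z (x s₁); hence the scaling by the gap d.
  copy⇒copyℤ : ∀ {S d bs} → Spread S d → (∀ {q} → q ∈ bs → q ∈ Ls) →
               ContainsCopyℚ S bs → ContainsCopyℤ S (map (λ q → + d ℤ.* Z q) bs)
  copy⇒copyℤ {bs = bs} (constant s₀ all≡s₀) _ (a , _ , b , on) =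
    1 , ℕP.≤-refl , V (line a b s₀) ℤ.- + s₀ ,
    All.zipWith (λ { (x∈ , refl) → subst (_∈ map V bs) (sym (offset s₀ (V (line a b s₀)))) (∈-map⁺ V x∈) }) (on , all≡s₀)
    where
    V : ℚ → ℤ
    V q = + 1 ℤ.* Z q
    offset : ∀ s v → + (1 ℕ.* s) ℤ.+ (v ℤ.- + s) ≡ v
    offset s v = trans (cong (λ n → + n ℤ.+ (v ℤ.- + s)) (ℕP.*-identityˡ s)) (cancel (+ s) v)
      where
      cancel : ∀ s v → s ℤ.+ (v ℤ.- s) ≡ v
      cancel = ℤ-solve-∀
  copy⇒copyℤ {bs = bs} (spread {s₁} {d} s₁∈ s₂∈) ⊆Ls (a , a>0 , b , on) =
    suc n , s≤s z≤n , β , All.map (λ {s} x∈ → subst (_∈ map V bs) (affine s (⊆Ls x∈)) (∈-map⁺ V x∈)) on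
    where
    V : ℚ → ℤ
    V q = + suc d ℤ.* Z q
    x = line a b
    s₂ = s₁ ℕ.+ suc d
    x₁∈ = ⊆Ls (All.lookup on s₁∈)
    x₂∈ = ⊆Ls (All.lookup on s₂∈)
    P = Z (x s₂) ℤ.- Z (x s₁)
    P>0 : 0ℤ ℤ.< P
    P>0 = subst (ℤ._< P) (ℤP.+-inverseʳ (Z (x s₁)))
      (ℤP.+-monoˡ-< (ℤ.- Z (x s₁)) (Z-line-< a b a>0 (ℕP.m<m+n s₁ (s≤s z≤n)) x₁∈ x₂∈))
    n = proj₁ (0<⇒≡+suc P>0)
    P≡1+n = proj₂ (0<⇒≡+suc P>0)
    β = V (x s₁) ℤ.- P ℤ.* + s₁
    affine : ∀ s → x s ∈ Ls → V (x s) ≡ + (suc n ℕ.* s) ℤ.+ β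
    affine s x∈ = begin
      V (x s)                                                    ≡⟨ split-at-s₁ (+ suc d) (Z (x s)) (Z (x s₁)) ⟩
      V (x s₁) ℤ.+ (Z (x s) ℤ.- Z (x s₁)) ℤ.* + suc d            ≡⟨ cong (λ t → V (x s₁) ℤ.+ t) (Z-line-proportional a b s₁ (suc d) s x₁∈ x₂∈ x∈) ⟩
      V (x s₁) ℤ.+ P ℤ.* (+ s ℤ.- + s₁)                          ≡⟨ regroup (V (x s₁)) P (+ s) (+ s₁) ⟩
      P ℤ.* + s ℤ.+ β                                            ≡⟨ cong (λ p → p ℤ.* + s ℤ.+ β) P≡1+n ⟩
      + suc n ℤ.* + s ℤ.+ β                                      ≡⟨ cong (ℤ._+ β) (ℤP.pos-* (suc n) s) ⟨
      + (suc n ℕ.* s) ℤ.+ β                                      ∎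
      where
      open ≡-Reasoning
      split-at-s₁ : ∀ d z z₁ → d ℤ.* z ≡ d ℤ.* z₁ ℤ.+ (z ℤ.- z₁) ℤ.* d
      split-at-s₁ = ℤ-solve-∀
      regroup : ∀ v p s s₁ → v ℤ.+ p ℤ.* (s ℤ.- s₁) ≡ p ℤ.* s ℤ.+ (v ℤ.- p ℤ.* s₁)
      regroup = ℤ-solve-∀

containsAffineCopy-⊆ : ∀ S {M M′} → M ⊆ M′ → ContainsAffineCopy S M → ContainsAffineCopy S M′
containsAffineCopy-⊆ S M⊆M′ (a , 1≤a , b , copy) =
  a , 1≤a , b , All.map (λ { (n , n∈M , n≡as+b) → n , M⊆M′ n∈M , n≡as+b }) copy

copyℤ⇒affineCopy : ∀ {S bs} {V : ℚ → ℤ} {h : ℚ → ℕ} c m → 1 ≤ m →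
  (∀ {q} → q ∈ bs → + h q ≡ c ℤ.+ + m ℤ.* V q) →
  ContainsCopyℤ S (map V bs) → ContainsAffineCopy S (map h bs)
copyℤ⇒affineCopy {bs = bs} {V} {h} c m 1≤m h≡c+mV (a , 1≤a , b , copy) =
  m ℕ.* a , ℕP.*-mono-≤ 1≤m 1≤a , c ℤ.+ + m ℤ.* b , All.map image copy
  where
  image : ∀ {s} → + (a ℕ.* s) ℤ.+ b ∈ map V bs →
          Σ ℕ λ n → n ∈ map h bs × + n ≡ + (m ℕ.* a ℕ.* s) ℤ.+ (c ℤ.+ + m ℤ.* b)
  image {s} z∈ with ∈-map⁻ V z∈
  ... | q , q∈ , z≡Vq = h q , ∈-map⁺ h q∈ , (begin
    + h q                                           ≡⟨ h≡c+mV q∈ ⟩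
    c ℤ.+ + m ℤ.* V q                               ≡⟨ cong (λ v → c ℤ.+ + m ℤ.* v) z≡Vq ⟨
    c ℤ.+ + m ℤ.* (+ (a ℕ.* s) ℤ.+ b)               ≡⟨ cong (λ v → c ℤ.+ + m ℤ.* (v ℤ.+ b)) (ℤP.pos-* a s) ⟩
    c ℤ.+ + m ℤ.* (+ a ℤ.* + s ℤ.+ b)               ≡⟨ distribute c (+ m) (+ a) (+ s) b ⟩
    + m ℤ.* + a ℤ.* + s ℤ.+ (c ℤ.+ + m ℤ.* b)       ≡⟨ cong (λ v → v ℤ.* + s ℤ.+ (c ℤ.+ + m ℤ.* b)) (ℤP.pos-* m a) ⟨
    + (m ℕ.* a) ℤ.* + s ℤ.+ (c ℤ.+ + m ℤ.* b)       ≡⟨ cong (ℤ._+ (c ℤ.+ + m ℤ.* b)) (ℤP.pos-* (m ℕ.* a) s) ⟨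
    + (m ℕ.* a ℕ.* s) ℤ.+ (c ℤ.+ + m ℤ.* b)         ∎)
    where
    open ≡-Reasoning
    distribute : ∀ c m a s b → c ℤ.+ m ℤ.* (a ℤ.* s ℤ.+ b) ≡ m ℤ.* a ℤ.* s ℤ.+ (c ℤ.+ m ℤ.* b)
    distribute = ℤ-solve-∀

-- Playing along the tree

Unique-++⁻ : ∀ {A : Set} (xs : List A) {ys} → Unique (xs ++ ys) → Unique xs × Unique ys × Disjoint xs ys
Unique-++⁻ [] unique = [] , unique , λ ()
Unique-++⁻ (x ∷ xs) (x∉ ∷ unique) with Unique-++⁻ xs unique
... | unique-xs , unique-ys , disjoint =
  All.++⁻ˡ xs x∉ ∷ unique-xs , unique-ys ,
  λ { (here refl , x∈ys) → All.lookup (All.++⁻ʳ xs x∉) x∈ys refl ; (there v∈xs , v∈ys) → disjoint (v∈xs , v∈ys) }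

Unique-map⁺-on : ∀ {A B : Set} {f : A → B} {xs} → (∀ {x y} → x ∈ xs → y ∈ xs → f x ≡ f y → x ≡ y) →
              Unique xs → Unique (map f xs)
Unique-map⁺-on _ [] = []
Unique-map⁺-on injective (x∉ ∷ unique) =
  All.map⁺ (All.tabulate λ y∈ fx≡fy → All.lookup x∉ y∈ (injective (here refl) (there y∈) fx≡fy)) ∷
  Unique-map⁺-on (λ x∈ y∈ → injective (there x∈) (there y∈)) unique

labels-child⊆ : ∀ {u us} → u ∈ us → labels u ⊆ labelsF us
labels-child⊆ (here refl) q∈ = ∈-++⁺ˡ q∈
labels-child⊆ {us = v ∷ _} (there u∈) q∈ = ∈-++⁺ʳ (labels v) (labels-child⊆ u∈ q∈)

branch⊆labels : ∀ {t bs} → Branch t bs → bs ⊆ labels t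
branch⊆labels leafB (here refl) = here refl
branch⊆labels (stepB _ _) (here refl) = here refl
branch⊆labels (stepB u∈ b) (there q∈) = there (labels-child⊆ u∈ (branch⊆labels b q∈))

module _ (f : ℚ → ℕ) where

  map-labels-child⊆ : ∀ {u us} → u ∈ us → map f (labels u) ⊆ map f (labelsF us)
  map-labels-child⊆ u∈ = Subset.map⁺ f (labels-child⊆ u∈)

  Unique-map-labelsF⁻ : ∀ u us → Unique (map f (labelsF (u ∷ us))) →
    Unique (map f (labels u)) × Unique (map f (labelsF us)) × Disjoint (map f (labels u)) (map f (labelsF us))
  Unique-map-labelsF⁻ u us = Unique-++⁻ (map f (labels u)) ∘′ subst Unique (map-++ f (labels u) (labelsF us))

  Unique-map-child : ∀ {u us} → u ∈ us → Unique (map f (labelsF us)) → Unique (map f (labels u))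
  Unique-map-child {us = u ∷ us} (here refl) unique = proj₁ (Unique-map-labelsF⁻ u us unique)
  Unique-map-child {us = v ∷ us} (there u∈) unique = Unique-map-child u∈ (proj₁ (proj₂ (Unique-map-labelsF⁻ v us unique)))

module _ (S : List ℕ) (f : ℚ → ℕ) where

  treeStrategy : ∀ {k t M B} → Depth≤ k t → AllInnerBranching t → Unique (map f (labels t)) →
    (∀ {q} → q ∈ labels t → f q ∉ M) → (∀ {q} → q ∈ labels t → f q ∉ B) →
    (∀ {bs} → Branch t bs → ContainsAffineCopy S (M ++ map f bs)) →
    MakerWinsWithin S (suc k) M B
  treeStrategy {t = node x []} {M} _ _ _ ∉M ∉B wins =
    f x , ∉M (here refl) , ∉B (here refl) ,
    inj₁ (containsAffineCopy-⊆ S (∈-resp-↭ (++-comm M (f x ∷ []))) (wins leafB))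
  treeStrategy {t = node x (_ ∷ [])} _ (nd (inj₂ (s≤s ())) _) _ _ _ _
  treeStrategy {suc k} {node x ts@(u₁ ∷ u₂ ∷ us)} {M} {B} (inner depths) (nd _ branchings) (fx∉ ∷ unique) ∉M ∉B wins =
    f x , ∉M (here refl) , ∉B (here refl) , inj₂ reply
    where
    descend : ∀ {u y} → u ∈ ts → y ∉ map f (labels u) → MakerWinsWithin S (suc k) (f x ∷ M) (y ∷ B)
    descend {u} {y} u∈ y∉u =
      treeStrategy (All.lookup depths u∈) (All.lookup branchings u∈) (Unique-map-child f u∈ unique) ∉M′ ∉B′ wins′
      where
      ∉M′ : ∀ {q} → q ∈ labels u → f q ∉ f x ∷ M
      ∉M′ q∈ (here fq≡fx) = All.lookup fx∉ (map-labels-child⊆ f u∈ (∈-map⁺ f q∈)) (sym fq≡fx)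
      ∉M′ q∈ (there fq∈M) = ∉M (there (labels-child⊆ u∈ q∈)) fq∈M
      ∉B′ : ∀ {q} → q ∈ labels u → f q ∉ y ∷ B
      ∉B′ q∈ (here fq≡y) = y∉u (subst (_∈ map f (labels u)) fq≡y (∈-map⁺ f q∈))
      ∉B′ q∈ (there fq∈B) = ∉B (there (labels-child⊆ u∈ q∈)) fq∈B
      wins′ : ∀ {bs} → Branch u bs → ContainsAffineCopy S ((f x ∷ M) ++ map f bs)
      wins′ {bs} b = containsAffineCopy-⊆ S (∈-resp-↭ (shift (f x) M (map f bs))) (wins (stepB u∈ b))
    reply : ∀ y → y ∉ f x ∷ M → y ∉ B → MakerWinsWithin S (suc k) (f x ∷ M) (y ∷ B)
    reply y _ _ with y ∈? map f (labels u₁)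
    ... | no y∉u₁ = descend (here refl) y∉u₁
    ... | yes y∈u₁ = descend (there (here refl)) λ y∈u₂ →
      proj₂ (proj₂ (Unique-map-labelsF⁻ f u₁ (u₂ ∷ us) unique)) (y∈u₁ , map-labels-child⊆ f {us = u₂ ∷ us} (here refl) y∈u₂)

-- Labelling the tree

∈⇒≤sum : ∀ {n ns} → n ∈ ns → n ≤ sum ns
∈⇒≤sum {ns = n ∷ ns} (here refl) = ℕP.m≤m+n n (sum ns)
∈⇒≤sum {ns = m ∷ _} (there n∈) = ℕP.≤-trans (∈⇒≤sum n∈) (ℕP.m≤n+m _ m)

∣i∣≤n⇒0≤n+i : ∀ n i → ℤ.∣ i ∣ ≤ n → 0ℤ ℤ.≤ + n ℤ.+ i
∣i∣≤n⇒0≤n+i n (+ _) _ = ℤ.+≤+ z≤n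
∣i∣≤n⇒0≤n+i n ℤ.-[1+ m ] m<n = subst (0ℤ ℤ.≤_) (sym (ℤP.⊖-≥ m<n)) (ℤ.+≤+ z≤n)

-- If m · w = g for some w ≠ 0, no other multiplier does this for w: start again above m.
multiplier-avoiding : (ws : List ℤ) (g : ℤ) (lo : ℕ) →
  Σ ℕ λ m → lo < m × m ≤ lo ℕ.+ 2 ^ length ws × All (λ w → w ≡ 0ℤ ⊎ + m ℤ.* w ≢ g) ws
multiplier-avoiding [] g lo = suc lo , ℕP.≤-refl , ℕP.≤-reflexive (ℕP.+-comm 1 lo) , []
multiplier-avoiding (w ∷ ws) g lo with multiplier-avoiding ws g lo
... | m , lo<m , m≤ , avoids with w ℤ.≟ 0ℤ | + m ℤ.* w ℤ.≟ g
... | yes w≡0 | _       = m , lo<m , ℕP.≤-trans m≤ (ℕP.+-monoʳ-≤ lo (ℕP.m≤n*m _ 2)) , inj₁ w≡0 ∷ avoids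
... | no _    | no mw≢g = m , lo<m , ℕP.≤-trans m≤ (ℕP.+-monoʳ-≤ lo (ℕP.m≤n*m _ 2)) , inj₂ mw≢g ∷ avoids
... | no w≢0  | yes mw≡g with multiplier-avoiding ws g m
... | m′ , m<m′ , m′≤ , avoids′ = m′ , ℕP.<-trans lo<m m<m′ , bound , inj₂ m′w≢g ∷ avoids′
  where
  m′w≢g : + m′ ℤ.* w ≢ g
  m′w≢g m′w≡g = ℕP.<-irrefl (cong ℤ.∣_∣ (ℤP.*-cancelʳ-≡ (+ m) (+ m′) w {{ℤ.≢-nonZero w≢0}} (trans mw≡g (sym m′w≡g)))) m<m′
  bound : m′ ≤ lo ℕ.+ 2 ^ suc (length ws)
  bound = begin
    m′                                   ≤⟨ m′≤ ⟩
    m ℕ.+ 2 ^ length ws                  ≤⟨ ℕP.+-monoˡ-≤ (2 ^ length ws) m≤ ⟩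
    lo ℕ.+ 2 ^ length ws ℕ.+ 2 ^ length ws ≡⟨ double lo (2 ^ length ws) ⟩
    lo ℕ.+ 2 ℕ.* 2 ^ length ws           ∎
    where
    open ℕP.≤-Reasoning
    double : ∀ a b → a ℕ.+ b ℕ.+ b ≡ a ℕ.+ 2 ℕ.* b
    double = ℕ-solve-∀

module Labelling (S : List ℕ) (q₀ : ℚ) (ts : List Tree)
                 (unique : Unique (labels (node q₀ ts)))
                 (copies : ∀ bs → Branch (node q₀ ts) bs → ContainsCopyℚ S bs) where

  Ls : List ℚ
  Ls = labels (node q₀ ts)

  open Clearing Ls

  d : ℕ
  d = proj₁ (spread? S)

  instance
    d-nonZero : ℕ.NonZero d
    d-nonZero = Spread⇒NonZero (proj₂ (spread? S))

  V : ℚ → ℤ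
  V q = + d ℤ.* Z q

  w : ℚ → ℤ
  w q = V q ℤ.- V q₀

  ws : List ℤ
  ws = map w Ls

  K : ℕ
  K = 2 ^ length ws

  R : ℕ
  R = K ℕ.* sum (map ℤ.∣_∣ ws)

  w-injective : ∀ {q q′} → q ∈ Ls → q′ ∈ Ls → w q ≡ w q′ → q ≡ q′
  w-injective {q} {q′} q∈ q′∈ wq≡wq′ = Z-injective q∈ q′∈ (ℤP.*-cancelˡ-≡ (+ d) (Z q) (Z q′) (begin
    V q              ≡⟨ add-back (V q) (V q₀) ⟩
    w q ℤ.+ V q₀     ≡⟨ cong (ℤ._+ V q₀) wq≡wq′ ⟩
    w q′ ℤ.+ V q₀    ≡⟨ add-back (V q′) (V q₀) ⟨
    V q′             ∎))
    where
    open ≡-Reasoning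
    add-back : ∀ v v₀ → v ≡ (v ℤ.- v₀) ℤ.+ v₀
    add-back = ℤ-solve-∀

  module Multiplier (m : ℕ) .{{_ : ℕ.NonZero m}} (m≤K : m ≤ K) where

    F : ℚ → ℤ
    F q = + R ℤ.+ + m ℤ.* w q

    f : ℚ → ℕ
    f q = ℤ.∣ F q ∣

    +f≡F : ∀ {q} → q ∈ Ls → + f q ≡ F q
    +f≡F {q} q∈ = ℤP.0≤i⇒+∣i∣≡i (∣i∣≤n⇒0≤n+i R (+ m ℤ.* w q) (begin
      ℤ.∣ + m ℤ.* w q ∣          ≡⟨ ℤP.∣i*j∣≡∣i∣*∣j∣ (+ m) (w q) ⟩
      m ℕ.* ℤ.∣ w q ∣            ≤⟨ ℕP.*-mono-≤ m≤K (∈⇒≤sum (∈-map⁺ ℤ.∣_∣ (∈-map⁺ w q∈))) ⟩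
      R                          ∎))
      where open ℕP.≤-Reasoning

    w≡0⇒f≡R : ∀ {q} → w q ≡ 0ℤ → f q ≡ R
    w≡0⇒f≡R wq≡0 = cong ℤ.∣_∣ (trans (cong (λ v → + R ℤ.+ + m ℤ.* v) wq≡0) (times-zero (+ R) (+ m)))
      where
      times-zero : ∀ r m → r ℤ.+ m ℤ.* 0ℤ ≡ r
      times-zero = ℤ-solve-∀

    f-root : f q₀ ≡ R
    f-root = w≡0⇒f≡R (ℤP.+-inverseʳ (V q₀))

    mw≡F-R : ∀ q → + m ℤ.* w q ≡ F q ℤ.- + R
    mw≡F-R q = cancel (+ R) (+ m ℤ.* w q)
      where
      cancel : ∀ r x → x ≡ (r ℤ.+ x) ℤ.- r
      cancel = ℤ-solve-∀

    f-injective : ∀ {q q′} → q ∈ Ls → q′ ∈ Ls → f q ≡ f q′ → q ≡ q′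
    f-injective {q} {q′} q∈ q′∈ fq≡fq′ = w-injective q∈ q′∈ (ℤP.*-cancelˡ-≡ (+ m) (w q) (w q′) (begin
      + m ℤ.* w q                ≡⟨ mw≡F-R q ⟩
      F q ℤ.- + R                ≡⟨ cong (ℤ._- + R) (trans (sym (+f≡F q∈)) (trans (cong +_ fq≡fq′) (+f≡F q′∈))) ⟩
      F q′ ℤ.- + R               ≡⟨ mw≡F-R q′ ⟨
      + m ℤ.* w q′               ∎))
      where open ≡-Reasoning

    f-unique : Unique (map f Ls)
    f-unique = Unique-map⁺-on f-injective unique

    f-wins : ∀ {bs} → Branch (node q₀ ts) bs → ContainsAffineCopy S (map f bs)
    f-wins {bs} b = copyℤ⇒affineCopy (+ R ℤ.- + m ℤ.* V q₀) m (ℕ.>-nonZero⁻¹ m) f≡c+mV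
      (copy⇒copyℤ (proj₂ (spread? S)) (branch⊆labels b) (copies bs b))
      where
      f≡c+mV : ∀ {q} → q ∈ bs → + f q ≡ (+ R ℤ.- + m ℤ.* V q₀) ℤ.+ + m ℤ.* V q
      f≡c+mV q∈ = trans (+f≡F (branch⊆labels b q∈)) (regroup (+ R) (+ m) (V _) (V q₀))
        where
        regroup : ∀ r m v v₀ → r ℤ.+ m ℤ.* (v ℤ.- v₀) ≡ (r ℤ.- m ℤ.* v₀) ℤ.+ m ℤ.* v
        regroup = ℤ-solve-∀

    f≡R⊎f≢y : ∀ {q y} → q ∈ Ls → w q ≡ 0ℤ ⊎ + m ℤ.* w q ≢ + y ℤ.- + R → f q ≡ R ⊎ f q ≢ y
    f≡R⊎f≢y _ (inj₁ wq≡0) = inj₁ (w≡0⇒f≡R wq≡0)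
    f≡R⊎f≢y {q} q∈ (inj₂ mwq≢y-R) =
      inj₂ λ fq≡y → mwq≢y-R (trans (mw≡F-R q) (cong (ℤ._- + R) (trans (sym (+f≡F q∈)) (cong +_ fq≡y))))

    descend : ∀ {k u} y → All (λ v → v ≡ 0ℤ ⊎ + m ℤ.* v ≢ + y ℤ.- + R) ws → u ∈ ts →
              Depth≤ k u → AllInnerBranching u → MakerWinsWithin S (suc k) (R ∷ []) (y ∷ [])
    descend {u = u} y avoids u∈ depth branching =
      treeStrategy S f depth branching (Unique-map-child f u∈ (AllPairs.tail f-unique)) ∉R ∉y wins
      where
      child≢R : ∀ {q} → q ∈ labels u → f q ≢ R
      child≢R q∈ fq≡R = All.lookup (AllPairs.head f-unique) (map-labels-child⊆ f u∈ (∈-map⁺ f q∈)) (trans f-root (sym fq≡R))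
      ∉R : ∀ {q} → q ∈ labels u → f q ∉ R ∷ []
      ∉R q∈ (here fq≡R) = child≢R q∈ fq≡R
      ∉y : ∀ {q} → q ∈ labels u → f q ∉ y ∷ []
      ∉y q∈ (here fq≡y) =
        [ child≢R q∈ , (λ fq≢y → fq≢y fq≡y) ]′ (f≡R⊎f≢y q∈Ls (All.lookup avoids (∈-map⁺ w q∈Ls)))
        where q∈Ls = there (labels-child⊆ u∈ q∈)
      wins : ∀ {bs} → Branch u bs → ContainsAffineCopy S (R ∷ map f bs)
      wins {bs} b = subst (λ r → ContainsAffineCopy S (r ∷ map f bs)) f-root (f-wins (stepB u∈ b))

  rootWins : Branch (node q₀ ts) (q₀ ∷ []) → ContainsAffineCopy S (R ∷ [])
  rootWins b = subst (λ r → ContainsAffineCopy S (r ∷ [])) f-root (f-wins b)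
    where open Multiplier 1 (ℕP.m^n>0 2 (length ws))

  winAfterReply : ∀ {k u} y → u ∈ ts → Depth≤ k u → AllInnerBranching u →
                  MakerWinsWithin S (suc k) (R ∷ []) (y ∷ [])
  winAfterReply y =
    let m , 0<m , m≤K , avoids = multiplier-avoiding ws (+ y ℤ.- + R) 0
    in Multiplier.descend m {{ℕ.>-nonZero 0<m}} m≤K y avoids

proposition2p1 : (S : List ℕ) (N : ℕ) → 1 ≤ N →
    (T : Tree) →
    Depth≤ (N ∸ 1) T →
    Unique (labels T) →
    (∀ bs → Branch T bs → ContainsCopyℚ S bs) →
    NonRootBranching T →
    HasNMoveStrategy S N
proposition2p1 S (suc _) _ (node q₀ []) _ unique copies _ =
  R , (λ ()) , (λ ()) , inj₁ (rootWins leafB)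
  where open Labelling S q₀ [] unique copies
proposition2p1 S (suc _) _ (node q₀ (u ∷ us)) (inner depths) unique copies (branching ∷ _) =
  R , (λ ()) , (λ ()) , inj₂ λ y _ _ → winAfterReply y (here refl) (All.head depths) branching
  where open Labelling S q₀ (u ∷ us) unique copies
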